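{- For every integer $m>0$, the graph $CC_{m+2}$ does not belong to $\mathcal{F}(TW_m)$.
   Context: For an integer $k\ge 0$, $CC_k$ is the graph with vertex set $K\cup K'$, where $K=\{v_0,\dots,v_k\}$ and $K'=\{v'_0,\dots,v'_k\}$, $K$ and $K'$ are cliques, and for $0\le i,j\le k$ the vertices $v_i$ and $v'_j$ are adjacent if and only if $j<i$; there are no other edges. Given a graph $H$ with vertex set $\{h_1,\dots,h_r\}$, $r>1$, and graphs $H_1,\dots,H_r$, the graph $H[H_1,\dots,H_r]$ is obtained from the disjoint union $H_1\cup\cdots\cup H_r$ by adding all edges between $V(H_i)$ and $V(H_j)$ for every edge $h_ih_j$ of $H$. For a class of graphs $\mathcal{C}$, $\mathcal{F}(\mathcal{C})$ is the class of graphs having a factor tree with label graphs in $\mathcal{C}$, defined recursively: a single-vertex graph is in $\mathcal{F}(\mathcal{C})$, and $G\in\mathcal{F}(\mathcal{C})$ if $G=H[H_1,\dots,H_r]$ for some $H\in\mathcal{C}$ with $r=|V(H)|>1$ vertices and graphs $H_1,\dots,H_r\in\mathcal{F}(\mathcal{C})$. For an integer $m$, $TW_m$ denotes the class of graphs of treewidth at most $m$. -}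

module Defs where

open import Level using (0ℓ)
open import Data.Nat using (ℕ; zero; suc; _+_; _≤_; _<_)
open import Data.Fin using (Fin; toℕ; splitAt)
open import Data.Fin.Subset using (Subset; _∈_; ∣_∣)
open import Data.List using (List; []; _∷_)
open import Data.List.Relation.Unary.Unique.Propositional using (Unique)
open import Data.Product using (Σ; ∃; _×_; _,_; proj₁; proj₂)
open import Data.Sum using (_⊎_; inj₁; inj₂)
open import Data.Empty using (⊥)
open import Relation.Nullary using (¬_)
open import Relation.Binary.PropositionalEquality using (_≡_; _≢_; refl)
open import Function.Bundles using (_↔_; Inverse)

record Graph : Set₁ where
  field
    size   : ℕ
    Adj    : Fin size → Fin size → Set
    sym    : ∀ {x y} → Adj x y → Adj y x
    irrefl : ∀ {x} → ¬ Adj x x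
open Graph public

data Walk (G : Graph) : Fin (size G) → Fin (size G) → Set where
  []  : ∀ {u} → Walk G u u
  _∷_ : ∀ {u w v} → Adj G u w → Walk G w v → Walk G u v

walkVertices : ∀ {G u v} → Walk G u v → List (Fin (size G))
walkVertices {u = u} []       = u ∷ []
walkVertices {u = u} (_ ∷ w)  = u ∷ walkVertices w

record Path (G : Graph) (u v : Fin (size G)) : Set where
  field
    walk   : Walk G u v
    unique : Unique (walkVertices walk)
open Path public

record IsTree (T : Graph) : Set where
  field
    path-exists : ∀ u v → Path T u v
    path-unique : ∀ {u v} (p q : Path T u v) →
                  walkVertices (walk p) ≡ walkVertices (walk q)

AllOn : ∀ {G u v} → (Fin (size G) → Set) → Walk G u v → Set
AllOn {u = u} P []      = P u
AllOn {u = u} P (_ ∷ w) = P u × AllOn P w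

record TreeDecomposition (G : Graph) (width : ℕ) : Set₁ where
  field
    T          : Graph
    tree       : IsTree T
    bag        : Fin (size T) → Subset (size G)
    bag-size   : ∀ t → ∣ bag t ∣ ≤ suc width
    vertex-cov : ∀ v → ∃ λ t → v ∈ bag t
    edge-cov   : ∀ u v → Adj G u v → ∃ λ t → (u ∈ bag t × v ∈ bag t)
    connected  : ∀ v s t → v ∈ bag s → v ∈ bag t →
                 Σ (Walk T s t) λ w → AllOn (λ x → v ∈ bag x) w

TW : ℕ → Graph → Set₁
TW m G = TreeDecomposition G m

module _ (H : Graph) (Hs : Fin (size H) → Graph) where
  SubstVertex : Set
  SubstVertex = Σ (Fin (size H)) λ i → Fin (size (Hs i))

  data SubstAdj : SubstVertex → SubstVertex → Set where
    inside : ∀ {i a b} → Adj (Hs i) a b → SubstAdj (i , a) (i , b)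
    across : ∀ {i j a b} → Adj H i j → SubstAdj (i , a) (j , b)

record IsSubst (G H : Graph) (Hs : Fin (size H) → Graph) : Set where
  field
    iso      : Fin (size G) ↔ SubstVertex H Hs
    adj-pres : ∀ x y → Adj G x y → SubstAdj H Hs (Inverse.to iso x) (Inverse.to iso y)
    adj-refl : ∀ x y → SubstAdj H Hs (Inverse.to iso x) (Inverse.to iso y) → Adj G x y

-- F(C): graphs having a factor tree with label graphs in C.

data InF (C : Graph → Set₁) : Graph → Set₁ where
  single : ∀ G → size G ≡ 1 → InF C G
  subst  : ∀ G H (Hs : Fin (size H) → Graph) →
           C H → 1 < size H →
           (∀ i → InF C (Hs i)) →
           IsSubst G H Hs →
           InF C G

-- CC_k : vertices v_0..v_k (first block) and v'_0..v'_k (second block).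

CCAdj' : ∀ {k} → Fin (suc k) ⊎ Fin (suc k) → Fin (suc k) ⊎ Fin (suc k) → Set
CCAdj' (inj₁ i) (inj₁ j) = i ≢ j
CCAdj' (inj₂ i) (inj₂ j) = i ≢ j
CCAdj' (inj₁ i) (inj₂ j) = toℕ j < toℕ i
CCAdj' (inj₂ j) (inj₁ i) = toℕ j < toℕ i

CCAdj'-sym : ∀ {k} (x y : Fin (suc k) ⊎ Fin (suc k)) → CCAdj' x y → CCAdj' y x
CCAdj'-sym (inj₁ i) (inj₁ j) p q = p (Relation.Binary.PropositionalEquality.sym q)
CCAdj'-sym (inj₂ i) (inj₂ j) p q = p (Relation.Binary.PropositionalEquality.sym q)
CCAdj'-sym (inj₁ i) (inj₂ j) p = p
CCAdj'-sym (inj₂ j) (inj₁ i) p = p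

CCAdj'-irrefl : ∀ {k} (x : Fin (suc k) ⊎ Fin (suc k)) → ¬ CCAdj' x x
CCAdj'-irrefl (inj₁ i) p = p refl
CCAdj'-irrefl (inj₂ i) p = p refl

CC : ℕ → Graph
CC k = record
  { size   = suc k + suc k
  ; Adj    = λ x y → CCAdj' (splitAt (suc k) x) (splitAt (suc k) y)
  ; sym    = λ {x} {y} → CCAdj'-sym (splitAt (suc k) x) (splitAt (suc k) y)
  ; irrefl = λ {x} → CCAdj'-irrefl (splitAt (suc k) x)
  }

module Submission where

-- A graph in F(C) with more than one vertex is a substitution
-- H[H_1,...,H_r] with H ∈ C, r > 1 and every H_i non-empty.  We show that
-- whenever CC_k = H[H_1,...,H_r] with r > 1 and non-empty H_i, the k+1
-- vertices of the clique K lie in pairwise distinct parts, and these parts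
-- are pairwise adjacent in H; so H contains a clique on k+1 = m+3 vertices.
-- But a graph of treewidth at most m has no clique on more than m+1 vertices.

open import Defs
open import Data.Nat using (ℕ; zero; suc; _+_; _<_; _≤_; z≤n; s≤s; s≤s⁻¹)
import Data.Nat.Properties as ℕP
open import Data.Fin as Fin using (Fin; zero; suc; toℕ; splitAt; _↑ˡ_; _↑ʳ_; fromℕ)
import Data.Fin.Properties as FinP
open import Data.Fin.Subset using (Subset; ∣_∣; inside; outside) renaming (_∈_ to _∈ₛ_)
import Data.Vec.Base as Vec
open import Data.Vec.Base using (_∷_)
open import Data.List.Relation.Unary.Any using (here; there; any?)
open import Data.List.Relation.Unary.All using ([])
open import Data.List.Relation.Unary.All.Properties.Core using (¬Any⇒All¬; All¬⇒¬Any)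
open import Data.List.Relation.Unary.AllPairs using ([]; _∷_)
open import Data.List.Relation.Unary.Unique.Propositional using (Unique)
open import Data.List.Membership.Propositional using (_∈_)
open import Data.List.Relation.Binary.Subset.Propositional using (_⊆_)
open import Data.Product using (Σ; _×_; _,_; proj₁; proj₂)
open import Data.Sum using (_⊎_; inj₁; inj₂)
open import Data.Empty using (⊥-elim)
open import Relation.Nullary using (¬_; yes; no)
open import Relation.Binary using (tri<; tri≈; tri>)
open import Relation.Binary.PropositionalEquality as ≡ using (_≡_; _≢_; refl; trans; cong)
open import Function using (_∘_; id)
open import Function.Bundles using (Inverse)
open import Function.Definitions using (Injective)

-- 1. Walks and paths in a graph

module WalksIn (G : Graph) where

  start∈ : ∀ {u v} (w : Walk G u v) → u ∈ walkVertices w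
  start∈ []      = here refl
  start∈ (_ ∷ _) = here refl

  allOn⇒∈ : ∀ {P : Fin (size G) → Set} {u v} (w : Walk G u v) → AllOn P w →
            ∀ {y} → y ∈ walkVertices w → P y
  allOn⇒∈ []      Pu        (here refl) = Pu
  allOn⇒∈ (_ ∷ _) (Pu , _)  (here refl) = Pu
  allOn⇒∈ (_ ∷ w) (_ , Pw)  (there y∈w) = allOn⇒∈ w Pw y∈w

  pathFrom : ∀ {u v x} (w : Walk G u v) → Unique (walkVertices w) →
             x ∈ walkVertices w →
             Σ (Path G x v) λ p → walkVertices (walk p) ⊆ walkVertices w
  pathFrom []      w! (here refl)  = record { walk = [] ; unique = w! } , id
  pathFrom []      w! (there ())
  pathFrom (e ∷ w) w! (here refl)  = record { walk = e ∷ w ; unique = w! } , id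
  pathFrom (e ∷ w) (_ ∷ w!) (there x∈w) =
    let (p , p⊆w) = pathFrom w w! x∈w in p , there ∘ p⊆w

  -- Every walk contains a path between its endpoints, using only vertices
  -- of the walk: cut out the loop at every repeated vertex.
  walk⇒path : ∀ {u v} (w : Walk G u v) →
              Σ (Path G u v) λ p → walkVertices (walk p) ⊆ walkVertices w
  walk⇒path [] = record { walk = [] ; unique = [] ∷ [] } , id
  walk⇒path {u} (e ∷ w) with walk⇒path w
  ... | p , p⊆w with any? (u Fin.≟_) (walkVertices (walk p))
  ...   | yes u∈p = let (q , q⊆p) = pathFrom (walk p) (unique p) u∈p
                    in q , there ∘ p⊆w ∘ q⊆p
  ...   | no  u∉p = record { walk = e ∷ walk p ; unique = ¬Any⇒All¬ _ u∉p ∷ unique p }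
                  , λ { (here eq) → here eq ; (there y∈p) → there (p⊆w y∈p) }

  -- Follow a repetition-free walk q from c until it first meets a path P
  -- from a to b (q ends at a, so it does), at x say; then continue along P.
  -- This is a path R from c to b through x, and R only uses vertices of q
  -- and P (the latter is what makes the recursion produce a path).
  detour : ∀ {a b c} (P : Path G a b) (q : Walk G c a) → Unique (walkVertices q) →
           Σ (Fin (size G)) λ x → x ∈ walkVertices (walk P) × x ∈ walkVertices q ×
             Σ (Path G c b) λ R → x ∈ walkVertices (walk R) ×
               (∀ {y} → y ∈ walkVertices (walk R) →
                        y ∈ walkVertices q ⊎ y ∈ walkVertices (walk P))
  detour {c = c} P q q! with any? (c Fin.≟_) (walkVertices (walk P))
  ... | yes c∈P = let (R , R⊆P) = pathFrom (walk P) (unique P) c∈P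
                  in c , c∈P , start∈ q , R , start∈ (walk R) , inj₂ ∘ R⊆P
  detour P []      q!         | no c∉P = ⊥-elim (c∉P (start∈ (walk P)))
  detour {c = c} P (e ∷ q) (c∉q ∷ q!) | no c∉P with detour P q q!
  ... | x , x∈P , x∈q , R , x∈R , R⊆q∪P =
        x , x∈P , there x∈q , eR , there x∈R , eR⊆q∪P
    where
    c∉R : ¬ (c ∈ walkVertices (walk R))
    c∉R c∈R with R⊆q∪P c∈R
    ... | inj₁ c∈q = All¬⇒¬Any c∉q c∈q
    ... | inj₂ c∈P = c∉P c∈P

    eR : Path G _ _
    eR = record { walk = e ∷ walk R ; unique = ¬Any⇒All¬ _ c∉R ∷ unique R }

    eR⊆q∪P : ∀ {y} → y ∈ walkVertices (walk eR) →
             y ∈ walkVertices (e ∷ q) ⊎ y ∈ walkVertices (walk P)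
    eR⊆q∪P (here eq)  = inj₁ (here eq)
    eR⊆q∪P (there y∈R) with R⊆q∪P y∈R
    ... | inj₁ y∈q = inj₁ (there y∈q)
    ... | inj₂ y∈P = inj₂ y∈P

-- 2. Subtrees of a tree and the Helly property

module SubtreesOf (T : Graph) (tree : IsTree T) where
  open IsTree tree
  open WalksIn T

  V : Set
  V = Fin (size T)

  Convex : (V → Set) → Set
  Convex S = ∀ {u v} (p : Path T u v) → S u → S v →
             ∀ {y} → y ∈ walkVertices (walk p) → S y

  -- Connected vertex sets of a tree are convex: a connecting walk inside S
  -- contains a path, and paths in a tree are unique.
  connected⇒convex : (S : V → Set) →
                     (∀ s t → S s → S t → Σ (Walk T s t) (AllOn S)) → Convex S
  connected⇒convex S connected p Su Sv {y} y∈p =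
    let (w , w⊆S) = connected _ _ Su Sv
        (q , q⊆w) = walk⇒path w
    in allOn⇒∈ w w⊆S (q⊆w (≡.subst (y ∈_) (path-unique p q) y∈p))

  -- Helly property for three sets: pairwise-meeting convex sets have a
  -- common vertex, namely the point where the paths a–b, c–a, c–b meet.
  helly₃ : (A B C : V → Set) → Convex A → Convex B → Convex C →
           ∀ {a b c} → A a → B a → B b → C b → A c → C c →
           Σ V λ x → A x × B x × C x
  helly₃ A B C convA convB convC {a} {b} {c} Aa Ba Bb Cb Ac Cc =
    let P = path-exists a b
        Q = path-exists c a
        (x , x∈P , x∈Q , R , x∈R , _) = detour P (walk Q) (unique Q)
    in x , convA Q Ac Aa x∈Q , convB P Ba Bb x∈P , convC R Cc Cb x∈R

  -- Helly property: finitely many pairwise-meeting convex sets have a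
  -- common vertex.  Induction: replace S₀, S₁ by the convex set S₀ ∩ S₁,
  -- which meets every other Sᵢ by 'helly₃'.
  helly : ∀ n (S : Fin (suc n) → V → Set) → (∀ i → Convex (S i)) →
          (∀ i j → Σ V λ t → S i t × S j t) → Σ V λ t → ∀ i → S i t
  helly zero S _ meet =
    let (t , S₀t , _) = meet zero zero in t , λ { zero → S₀t }
  helly (suc n) S conv meet =
    let (t , inMerged) = helly n merged mergedConvex mergedMeet
    in t , λ { zero          → proj₁ (inMerged zero)
             ; (suc zero)    → proj₂ (inMerged zero)
             ; (suc (suc i)) → inMerged (suc i) }
    where
    merged : Fin (suc n) → V → Set
    merged zero    t = S zero t × S (suc zero) t
    merged (suc i) t = S (suc (suc i)) t

    mergedConvex : ∀ i → Convex (merged i)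
    mergedConvex zero p (S₀u , S₁u) (S₀v , S₁v) y∈p =
      conv zero p S₀u S₀v y∈p , conv (suc zero) p S₁u S₁v y∈p
    mergedConvex (suc i) = conv (suc (suc i))

    meetsMerged : ∀ i → Σ V λ x → merged zero x × S (suc (suc i)) x
    meetsMerged i =
      let (a , S₀a , S₁a) = meet zero (suc zero)
          (b , S₁b , Sᵢb) = meet (suc zero) (suc (suc i))
          (c , S₀c , Sᵢc) = meet zero (suc (suc i))
          (x , S₀x , S₁x , Sᵢx) = helly₃ _ _ _ (conv zero) (conv (suc zero))
                                    (conv (suc (suc i))) S₀a S₁a S₁b Sᵢb S₀c Sᵢc
      in x , (S₀x , S₁x) , Sᵢx

    mergedMeet : ∀ i j → Σ V λ t → merged i t × merged j t
    mergedMeet zero    zero    = let (t , S₀t , S₁t) = meet zero (suc zero)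
                                 in t , (S₀t , S₁t) , (S₀t , S₁t)
    mergedMeet zero    (suc j) = meetsMerged j
    mergedMeet (suc i) zero    = let (t , S₀₁t , Sᵢt) = meetsMerged i in t , Sᵢt , S₀₁t
    mergedMeet (suc i) (suc j) = meet (suc (suc i)) (suc (suc j))

-- 3. Counting elements of a subset

rank : ∀ {n} (p : Subset n) {x} → x ∈ₛ p → Fin ∣ p ∣
rank (inside  ∷ p) Vec.here        = zero
rank (inside  ∷ p) (Vec.there x∈p) = suc (rank p x∈p)
rank (outside ∷ p) (Vec.there x∈p) = rank p x∈p

rank-injective : ∀ {n} (p : Subset n) {x y} (x∈p : x ∈ₛ p) (y∈p : y ∈ₛ p) →
                 rank p x∈p ≡ rank p y∈p → x ≡ y
rank-injective (inside  ∷ p) Vec.here        Vec.here        _  = refl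
rank-injective (inside  ∷ p) (Vec.there x∈p) (Vec.there y∈p) eq =
  cong suc (rank-injective p x∈p y∈p (FinP.suc-injective eq))
rank-injective (outside ∷ p) (Vec.there x∈p) (Vec.there y∈p) eq =
  cong suc (rank-injective p x∈p y∈p eq)

injection⇒≤∣∣ : ∀ {k n} (p : Subset n) (f : Fin k → Fin n) →
                Injective _≡_ _≡_ f → (∀ i → f i ∈ₛ p) → k ≤ ∣ p ∣
injection⇒≤∣∣ p f f-inj f∈p =
  FinP.injective⇒≤ (λ eq → f-inj (rank-injective p (f∈p _) (f∈p _) eq))

-- 4. Cliques and tree decompositions

-- A clique on n vertices lies in a single bag of any tree decomposition:
-- the subtrees {t | v ∈ bag t} of its vertices are convex (connectivity
-- axiom) and pairwise meet (edge axiom), so Helly applies.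
clique≤width+1 : ∀ {G width n} → TreeDecomposition G width →
                 (f : Fin n → Fin (size G)) → Injective _≡_ _≡_ f →
                 (∀ i j → i ≢ j → Adj G (f i) (f j)) → n ≤ suc width
clique≤width+1 {n = zero}  _  _ _     _      = z≤n
clique≤width+1 {n = suc n} td f f-inj clique =
  ℕP.≤-trans (injection⇒≤∣∣ (bag t) f f-inj f∈bag) (bag-size t)
  where
  open TreeDecomposition td
  open SubtreesOf T tree

  holds : Fin (suc n) → V → Set
  holds i t = f i ∈ₛ bag t

  meet : ∀ i j → Σ V λ t → holds i t × holds j t
  meet i j with i Fin.≟ j
  ... | yes refl = let (t , fi∈t) = vertex-cov (f i) in t , fi∈t , fi∈t
  ... | no  i≢j  = edge-cov _ _ (clique i j i≢j)

  common : Σ V λ t → ∀ i → holds i t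
  common = helly n holds (λ i → connected⇒convex (holds i) (connected (f i))) meet

  t : V
  t = proj₁ common

  f∈bag : ∀ i → f i ∈ₛ bag t
  f∈bag = proj₂ common

-- 5. Substitutions

another : ∀ {n} → 1 < n → (q : Fin n) → Σ (Fin n) λ j → j ≢ q
another {suc zero} (s≤s ()) _
another {suc (suc _)} _ q = Fin.punchIn q zero , FinP.punchInᵢ≢i q zero

vertexOf : ∀ {C G} → InF C G → Fin (size G)
vertexOf (single G size≡1) = Fin.cast (≡.sym size≡1) zero
vertexOf (subst G H Hs _ 1<r factors isub) =
  Inverse.from (IsSubst.iso isub) (i , vertexOf (factors i))
  where
  i : Fin (size H)
  i = Fin.fromℕ< (ℕP.<⇒≤ 1<r)

across-parts : ∀ {H Hs} {x y : SubstVertex H Hs} → SubstAdj H Hs x y →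
               proj₁ x ≢ proj₁ y → Adj H (proj₁ x) (proj₁ y)
across-parts (inside _) x≢y = ⊥-elim (x≢y refl)
across-parts (across h) _   = h

module Parts {G H : Graph} {Hs : Fin (size H) → Graph} (isub : IsSubst G H Hs) where
  open IsSubst isub
  open Inverse iso

  part : Fin (size G) → Fin (size H)
  part x = proj₁ (to x)

  adj-between : ∀ {x y} → Adj G x y → part x ≢ part y → Adj H (part x) (part y)
  adj-between {x} {y} xy = across-parts (adj-pres x y xy)

  -- Parts are modules: a vertex outside part q sees all of it or none of it.
  -- So a vertex adjacent to one vertex of q but not to another lies in q.
  inside-part : ∀ {q a b z} → part a ≡ q → part b ≡ q →
                Adj G z a → ¬ Adj G z b → part z ≡ q
  inside-part {q} {a} {b} {z} a∈q b∈q za ¬zb with part z Fin.≟ q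
  ... | yes z∈q = z∈q
  ... | no  z∉q = ⊥-elim (¬zb (adj-refl z b (across zb-in-H)))
    where
    zb-in-H : Adj H (part z) (part b)
    zb-in-H = ≡.subst (Adj H (part z)) (trans a∈q (≡.sym b∈q))
                (adj-between za λ z~a → z∉q (trans z~a a∈q))

  escape : 1 < size H → (∀ i → Fin (size (Hs i))) →
           ∀ q → Σ (Fin (size G)) λ w → part w ≢ q
  escape 1<r element q =
    let (j , j≢q) = another 1<r q
    in from (j , element j) , j≢q ∘ trans (≡.sym (cong proj₁ (strictlyInverseˡ (j , element j))))

-- 6. Substitutions producing CC_k

module CCParts (k : ℕ) {H : Graph} {Hs : Fin (size H) → Graph}
               (isub : IsSubst (CC k) H Hs) where
  open Parts isub public

  N : ℕ
  N = suc k

  vL vR : Fin N → Fin (size (CC k))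
  vL l = l ↑ˡ N
  vR l = N ↑ʳ l

  adjLL : ∀ i j → i ≢ j → Adj (CC k) (vL i) (vL j)
  adjLL i j i≢j rewrite FinP.splitAt-↑ˡ N i N | FinP.splitAt-↑ˡ N j N = i≢j

  adjRR : ∀ i j → i ≢ j → Adj (CC k) (vR i) (vR j)
  adjRR i j i≢j rewrite FinP.splitAt-↑ʳ N N i | FinP.splitAt-↑ʳ N N j = i≢j

  adjRL : ∀ i j → toℕ i < toℕ j → Adj (CC k) (vR i) (vL j)
  adjRL i j i<j rewrite FinP.splitAt-↑ʳ N N i | FinP.splitAt-↑ˡ N j N = i<j

  nonadjRL : ∀ i j → ¬ toℕ i < toℕ j → ¬ Adj (CC k) (vR i) (vL j)
  nonadjRL i j i≮j rewrite FinP.splitAt-↑ʳ N N i | FinP.splitAt-↑ˡ N j N = i≮j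

  nonadjLR : ∀ i j → ¬ toℕ j < toℕ i → ¬ Adj (CC k) (vL i) (vR j)
  nonadjLR i j j≮i rewrite FinP.splitAt-↑ˡ N i N | FinP.splitAt-↑ʳ N N j = j≮i

  vertex-cases : ∀ w → (Σ (Fin N) λ l → vL l ≡ w) ⊎ (Σ (Fin N) λ l → vR l ≡ w)
  vertex-cases w with splitAt N w in eq
  ... | inj₁ l = inj₁ (l , FinP.splitAt⁻¹-↑ˡ eq)
  ... | inj₂ l = inj₂ (l , FinP.splitAt⁻¹-↑ʳ eq)

  last : Fin N
  last = fromℕ k

  last≮ : ∀ l → ¬ toℕ last < toℕ l
  last≮ l = ℕP.≤⇒≯ (FinP.≤fromℕ l)

  -- If v_i, v_j (i < j) share a part p, then p is everything:
  -- v'_i is adjacent to v_j but not v_i; v'_k is adjacent to v'_i but not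
  -- to v_i; every other v_l is adjacent to v_i but not v'_k; and every other
  -- v'_l is adjacent to v'_k but not to v_0.
  collapse : ∀ {i j} → i Fin.< j → part (vL j) ≡ part (vL i) →
             ∀ w → part w ≡ part (vL i)
  collapse {i} {j} i<j vj∈p = every
    where
    i<last : i Fin.< last
    i<last = ℕP.<-≤-trans i<j (FinP.≤fromℕ j)

    vRi∈p : part (vR i) ≡ part (vL i)
    vRi∈p = inside-part vj∈p refl (adjRL i j i<j) (nonadjRL i i (ℕP.<-irrefl refl))

    vRlast∈p : part (vR last) ≡ part (vL i)
    vRlast∈p = inside-part vRi∈p refl
                 (adjRR last i (λ last≡i → FinP.<-irrefl (≡.sym last≡i) i<last))
                 (nonadjRL last i (ℕP.<-asym i<last))

    vL∈p : ∀ l → part (vL l) ≡ part (vL i)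
    vL∈p l with l Fin.≟ i
    ... | yes refl = refl
    ... | no  l≢i  = inside-part refl vRlast∈p (adjLL l i l≢i) (nonadjLR l last (last≮ l))

    vR∈p : ∀ l → part (vR l) ≡ part (vL i)
    vR∈p l with l Fin.≟ last
    ... | yes refl = vRlast∈p
    ... | no  l≢last = inside-part vRlast∈p (vL∈p zero)
                         (adjRR l last l≢last) (nonadjRL l zero λ ())

    every : ∀ w → part w ≡ part (vL i)
    every w with vertex-cases w
    ... | inj₁ (l , refl) = vL∈p l
    ... | inj₂ (l , refl) = vR∈p l

  K-separated : (∀ q → Σ (Fin (size (CC k))) λ w → part w ≢ q) →
                Injective _≡_ _≡_ (part ∘ vL)
  K-separated escape {i} {j} vi~vj with FinP.<-cmp i j
  ... | tri< i<j _ _ = let (w , w∉) = escape (part (vL i))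
                       in ⊥-elim (w∉ (collapse i<j (≡.sym vi~vj) w))
  ... | tri≈ _ i≡j _ = i≡j
  ... | tri> _ _ j<i = let (w , w∉) = escape (part (vL j))
                       in ⊥-elim (w∉ (collapse j<i vi~vj w))

  K-adjacent : (∀ q → Σ (Fin (size (CC k))) λ w → part w ≢ q) →
               ∀ i j → i ≢ j → Adj H (part (vL i)) (part (vL j))
  K-adjacent escape i j i≢j = adj-between (adjLL i j i≢j) (i≢j ∘ K-separated escape)

-- A single-vertex graph is not CC_{m+2}, which has 2(m+3)
-- vertices; a substitution H[...] with H ∈ TW_m would give H a clique on
-- m+3 vertices.  (The argument does not need m > 0.)

theorem1 : ∀ (m : ℕ) → 0 < m → ¬ InF (TW m) (CC (m + 2))
theorem1 m _ (single _ size≡1) = ℕP.m+1+n≢0 (m + 2) (ℕP.suc-injective size≡1)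
theorem1 m _ (subst _ H Hs H∈TWm 1<r factors isub) =
  ℕP.m+1+n≰m m (s≤s⁻¹ K-fits-in-bag)
  where
  open CCParts (m + 2) isub

  noPartIsEverything : ∀ q → Σ (Fin (size (CC (m + 2)))) λ w → part w ≢ q
  noPartIsEverything = escape 1<r (λ i → vertexOf (factors i))

  K-fits-in-bag : suc (m + 2) ≤ suc m
  K-fits-in-bag = clique≤width+1 H∈TWm (part ∘ vL)
                    (K-separated noPartIsEverything) (K-adjacent noPartIsEverything)
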